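{- For every graph $G$ with $pw(G)\le 2$, $\chi_c^{\bullet}(G)\le pw(G)+1$.
   Context: $pw(G)$ denotes the pathwidth of $G$: the minimum over all path decompositions (sequences of vertex subsets $X_1,\dots,X_r$ covering every vertex and both ends of every edge, with the bags containing any given vertex forming an interval) of $\max_i|X_i|-1$. A correspondence-cover of a graph $G$ is a pair $(L,H)$ where $H$ is a graph and $L:V(G)\to 2^{V(H)}$ satisfies: the sets $L(v)$ partition $V(H)$; each $L(v)$ induces a clique in $H$; if $uv\notin E(G)$ ($u\ne v$) there are no edges of $H$ between $L(u)$ and $L(v)$; if $uv\in E(G)$ the edges between $L(u)$ and $L(v)$ form a matching. It is $k$-fold if $|L(v)|=k$ for all $v$. An independent transversal is an independent set $I$ of $H$ with $|I\cap L(v)|=1$ for all $v$. The cover admits a fractional packing if there is a probability distribution on independent transversals $I$ with $\mathbb{P}(x\in I)\ge 1/|L(v)|$ for all $v$ and $x\in L(v)$. $\chi_c^{\bullet}(G)$ is the least integer $k$ such that every $k$-fold correspondence-cover of $G$ admits a fractional packing. -}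

module Defs where

open import Data.Nat using (ℕ; suc; _≤_)
open import Data.Bool using (Bool; true; false)
open import Data.Fin using (Fin; _≟_) renaming (_≤_ to _≤ᶠ_)
open import Data.Fin.Subset using (Subset; _∈_; ∣_∣)
open import Data.Product using (Σ; ∃; _×_)
open import Data.List using (List; []; _∷_)
open import Relation.Nullary using (¬_; yes; no)
open import Relation.Binary.PropositionalEquality using (_≡_)
open import Data.Rational using (ℚ; 0ℚ; 1ℚ; _+_; _*_) renaming (_≤_ to _≤ℚ_)
import Data.Rational as ℚ
open import Data.Integer using (+_)

record Graph (n : ℕ) : Set where
  field
    adj     : Fin n → Fin n → Bool
    adj-sym : ∀ u v → adj u v ≡ adj v u
    adj-irr : ∀ v → adj v v ≡ false
open Graph public

record PathDecomposition {n : ℕ} (G : Graph n) : Set where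
  field
    r        : ℕ
    bag      : Fin r → Subset n
    covers-v : ∀ v → ∃ λ i → v ∈ bag i
    covers-e : ∀ u v → adj G u v ≡ true → ∃ λ i → (u ∈ bag i) × (v ∈ bag i)
    interval : ∀ v (i j l : Fin r) → i ≤ᶠ j → j ≤ᶠ l →
               v ∈ bag i → v ∈ bag l → v ∈ bag j
open PathDecomposition public

-- width ≤ p  (i.e. max_i |X_i| - 1 ≤ p)
WidthAtMost : ∀ {n} {G : Graph n} → PathDecomposition G → ℕ → Set
WidthAtMost D p = ∀ i → ∣ bag D i ∣ ≤ suc p

PathwidthAtMost : ∀ {n} → Graph n → ℕ → Set
PathwidthAtMost G p = Σ (PathDecomposition G) λ D → WidthAtMost D p

-- A k-fold correspondence-cover (L,H) of G, with V(H) = Fin n × Fin k and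
-- L(v) = {v} × Fin k.  E u i v j says (u,i)(v,j) ∈ E(H).
record KFoldCover {n : ℕ} (G : Graph n) (k : ℕ) : Set where
  field
    E          : Fin n → Fin k → Fin n → Fin k → Bool
    E-sym      : ∀ u i v j → E u i v j ≡ E v j u i
    E-irr      : ∀ v i → E v i v i ≡ false
    clique     : ∀ v i j → ¬ (i ≡ j) → E v i v j ≡ true
    nonadj     : ∀ u v i j → ¬ (u ≡ v) → adj G u v ≡ false → E u i v j ≡ false
    matching   : ∀ u v i j j' → ¬ (u ≡ v) →
                 E u i v j ≡ true → E u i v j' ≡ true → j ≡ j'
open KFoldCover public

-- A transversal picks exactly one vertex of each L(v): a function Fin n → Fin k.
Transversal : ℕ → ℕ → Set
Transversal n k = Fin n → Fin k

IndependentTransversal : ∀ {n k} {G : Graph n} → KFoldCover G k → Transversal n k → Set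
IndependentTransversal C t = ∀ u v → E C u (t u) v (t v) ≡ false

Distribution : Set → Set
Distribution A = List (ℚ × A)

open Data.Product using (_,_)

totalMass : ∀ {A} → Distribution A → ℚ
totalMass [] = 0ℚ
totalMass ((w , _) ∷ d) = w + totalMass d

probHit : ∀ {n k} → Distribution (Transversal n k) → Fin n → Fin k → ℚ
probHit [] v x = 0ℚ
probHit ((w , t) ∷ d) v x with t v ≟ x
... | yes _ = w + probHit d v x
... | no  _ = probHit d v x

data AllEntries {A : Set} (P : ℚ → A → Set) : Distribution A → Set where
  []  : AllEntries P []
  _∷_ : ∀ {w a d} → P w a → AllEntries P d → AllEntries P ((w , a) ∷ d)

-- Fractional packing: a probability distribution on independent transversals
-- with P(x ∈ I) ≥ 1/|L(v)| = 1/k, written as k · P(x ∈ I) ≥ 1.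
FractionalPacking : ∀ {n k} {G : Graph n} → KFoldCover G k → Set
FractionalPacking {n} {k} C =
  Σ (Distribution (Transversal n k)) λ d →
    AllEntries (λ w t → (0ℚ ≤ℚ w) × IndependentTransversal C t) d
    × totalMass d ≡ 1ℚ
    × (∀ v x → 1ℚ ≤ℚ ((+ k ℚ./ 1) * probHit d v x))

-- χ_c^•(G) ≤ m : the least k such that every k-fold cover admits a
-- fractional packing is at most m, i.e. some k ≤ m has this property.
ChiCBulletAtMost : ∀ {n} → Graph n → ℕ → Set
ChiCBulletAtMost G m = ∃ λ k → (k ≤ m) × (∀ (C : KFoldCover G k) → FractionalPacking C)

{-# OPTIONS --safe #-}
-- Order the vertices by the first bag containing them. The mates of v, the earlier vertices of
-- its first bag, include all earlier neighbours of v, and there are at most p of them. Colouring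
-- the vertices in this order with k = p + 1 colours, we maintain a list of transversals that are
-- independent on the coloured vertices and whose uniform distribution gives each of these a
-- uniform colour, and gives any two mates of a common vertex a pair of colours that is uniform on
-- the pairs (i , j) with j ≢ σ i, for some permutation σ. The edges of H between a mate a and v
-- form a matching, which extends to a permutation ρ. With no mate, v gets a uniform colour; with
-- one mate a, a uniform colour other than ρ (t a). With two mates a and b (so p = 2), at most one
-- of them, say a, is paired with v later; given t a = i, the two equally likely values j of t b
-- are sent bijectively onto the two colours other than ρ₁ i while avoiding ρ₂ j, which a 2 × 2
-- Hall argument allows. In every case v becomes uniform and (a , v) uniform off ρ (or ρ₁).
-- Weighting the final list uniformly gives the fractional packing.
module Submission where

open import Defs
open import Data.Bool as Bool using (true; false; if_then_else_)
open import Data.Bool.Properties using (¬-not)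
open import Data.Empty using (⊥; ⊥-elim)
open import Data.Fin as Fin using (Fin; zero; suc; toℕ; punchIn; punchOut; _≟_)
open import Data.Fin.Patterns using (0F; 1F)
open import Data.Fin.Permutation as Perm using (Permutation′; _⟨$⟩ʳ_; _⟨$⟩ˡ_)
open import Data.Fin.Properties
  using (0≢1+n; any?; toℕ<n; toℕ-injective; punchIn-injective; punchInᵢ≢i; punchIn-punchOut; punchOut-cong; punchOut-punchIn)
open import Data.Fin.Subset using (Subset; _∈_; ∣_∣)
open import Data.Fin.Subset.Properties using (_∈?_; x∈p∧x≢y⇒x∈p-y; x∈p⇒∣p-x∣<∣p∣)
import Data.Integer as ℤ
import Data.Integer.Properties as ℤ
open import Data.List using (List; []; _∷_; _++_; map; length; concatMap; tabulate; filter; allFin)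
open import Data.List.Membership.Propositional using () renaming (_∈_ to _∈ₗ_)
open import Data.List.Membership.Propositional.Properties using (∈-filter⁺; ∈-filter⁻; ∈-allFin)
open import Data.List.Properties using (map-++)
open import Data.List.Relation.Unary.All as All using (All; []; _∷_)
open import Data.List.Relation.Unary.All.Properties using (concat⁺; map⁺; tabulate⁺)
open import Data.List.Relation.Unary.AllPairs using ([]; _∷_)
open import Data.List.Relation.Unary.Any using (here; there)
open import Data.List.Relation.Unary.Unique.Propositional using (Unique)
import Data.List.Relation.Unary.Unique.Propositional.Properties as Unique
open import Data.Nat as ℕ using (ℕ; zero; suc; _+_; _*_; _≤_; _<_; _<?_; z≤n; s≤s; s≤s⁻¹; NonZero; >-nonZero)
open import Data.Nat.Coprimality as Coprime using (1-coprimeTo)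
open import Data.Nat.ListAction using (sum)
open import Data.Nat.ListAction.Properties using (sum-++)
open import Data.Nat.Properties hiding (_≟_; 0≢1+n)
open import Algebra.Properties.CommutativeSemigroup *-commutativeSemigroup using (x∙yz≈y∙xz)
open import Algebra.Properties.Semiring.Sum +-*-semiring
  using (sum-syntax; sum-cong-≗; sum-remove; ∑-distrib-+; ∑-comm; ∑-permute)
open import Data.Product using (Σ; ∃; _×_; _,_; proj₁; proj₂)
open import Data.Rational as ℚ using (ℚ; mkℚ; 0ℚ; 1ℚ; 1/_)
import Data.Rational.Properties as ℚ
import Data.Rational.Unnormalised as ℚᵘ
import Data.Rational.Unnormalised.Properties as ℚᵘ
open import Data.Sum as Sum using (_⊎_; inj₁; inj₂)
open import Data.Vec.Functional using (updateAt)
open import Data.Vec.Functional.Properties using (updateAt-updates; updateAt-minimal)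
open import Function using (_∘_; case_of_)
open import Relation.Binary using (tri<; tri≈; tri>)
open import Relation.Binary.PropositionalEquality
open import Relation.Nullary using (Dec; yes; no; does; ¬_)
open import Relation.Nullary.Decidable using (_×-dec_; ¬?)

indicator : ∀ {A : Set} → Dec A → ℕ
indicator d = if does d then 1 else 0

∑ₗ : ∀ {A : Set} → List A → (A → ℕ) → ℕ
∑ₗ T f = sum (map f T)

infixl 10 ∑ₗ
syntax ∑ₗ T (λ t → e) = ∑[ t ∈ T ] e

∑ₗ-cong : ∀ {A : Set} (T : List A) {f g : A → ℕ} → (∀ t → f t ≡ g t) → ∑ₗ T f ≡ ∑ₗ T g
∑ₗ-cong []      f≗g = refl
∑ₗ-cong (t ∷ T) f≗g = cong₂ _+_ (f≗g t) (∑ₗ-cong T f≗g)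

∑ₗ-*ˡ : ∀ {A : Set} (T : List A) c (f : A → ℕ) → ∑[ t ∈ T ] (c * f t) ≡ c * ∑ₗ T f
∑ₗ-*ˡ []      c f = sym (*-zeroʳ c)
∑ₗ-*ˡ (t ∷ T) c f = trans (cong ((c * f t) +_) (∑ₗ-*ˡ T c f)) (sym (*-distribˡ-+ c (f t) _))

∑ₗ-const : ∀ {A : Set} (T : List A) c → ∑[ t ∈ T ] c ≡ length T * c
∑ₗ-const []      c = refl
∑ₗ-const (t ∷ T) c = cong (c +_) (∑ₗ-const T c)

length≡∑1 : ∀ {A : Set} (T : List A) → length T ≡ ∑[ t ∈ T ] 1
length≡∑1 T = sym (trans (∑ₗ-const T 1) (*-identityʳ (length T)))

∑ₗ-concatMap : ∀ {A B : Set} (h : A → List B) (T : List A) (f : B → ℕ) →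
               ∑ₗ (concatMap h T) f ≡ ∑[ t ∈ T ] ∑ₗ (h t) f
∑ₗ-concatMap h []      f = refl
∑ₗ-concatMap h (t ∷ T) f = begin
  sum (map f (h t ++ concatMap h T))             ≡⟨ cong sum (map-++ f (h t) (concatMap h T)) ⟩
  sum (map f (h t) ++ map f (concatMap h T))     ≡⟨ sum-++ (map f (h t)) _ ⟩
  ∑ₗ (h t) f + ∑ₗ (concatMap h T) f              ≡⟨ cong (∑ₗ (h t) f +_) (∑ₗ-concatMap h T f) ⟩
  ∑ₗ (h t) f + ∑[ t ∈ T ] ∑ₗ (h t) f             ∎
  where open ≡-Reasoning

∑ₗ-tabulate : ∀ {A : Set} {D} (h : Fin D → A) (f : A → ℕ) → ∑ₗ (tabulate h) f ≡ ∑[ s < D ] f (h s)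
∑ₗ-tabulate {D = zero}  h f = refl
∑ₗ-tabulate {D = suc D} h f = cong (f (h zero) +_) (∑ₗ-tabulate (h ∘ suc) f)

∑-const : ∀ m c → ∑[ i < m ] c ≡ m * c
∑-const zero    c = refl
∑-const (suc m) c = cong (c +_) (∑-const m c)

∑-indicator : ∀ {k} (x : Fin k) → ∑[ i < k ] indicator (i ≟ x) ≡ 1
∑-indicator {suc k} zero    = cong suc (trans (∑-const k 0) (*-zeroʳ k))
∑-indicator {suc k} (suc x) = ∑-indicator x

∑-punchIn : ∀ {p} (g : Fin (suc p) → ℕ) x → g x + ∑[ s < p ] g (punchIn x s) ≡ ∑[ i < suc p ] g i
∑-punchIn g x = sym (sum-remove {i = x} g)

∑-punchIn-permute : ∀ {p} (π : Permutation′ (suc p)) (g : Fin (suc p) → ℕ) →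
                    ∑[ i < suc p ] ∑[ s < p ] g (punchIn (π ⟨$⟩ʳ i) s) ≡ p * ∑[ i < suc p ] g i
∑-punchIn-permute {p} π g = +-cancelˡ-≡ (∑ g) _ _ (begin
  ∑ g + ∑ avoid                          ≡⟨ cong (_+ ∑ avoid) (∑-permute g π) ⟩
  ∑ (g ∘ (π ⟨$⟩ʳ_)) + ∑ avoid            ≡⟨ ∑-distrib-+ (g ∘ (π ⟨$⟩ʳ_)) avoid ⟨
  ∑[ i < suc p ] (g (π ⟨$⟩ʳ i) + avoid i) ≡⟨ sum-cong-≗ (∑-punchIn g ∘ (π ⟨$⟩ʳ_)) ⟩
  ∑[ i < suc p ] ∑ g                     ≡⟨ ∑-const (suc p) (∑ g) ⟩
  suc p * ∑ g                            ∎)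
  where
  open ≡-Reasoning
  avoid : Fin (suc p) → ℕ
  avoid i = ∑[ s < p ] g (punchIn (π ⟨$⟩ʳ i) s)
  ∑ : (Fin (suc p) → ℕ) → ℕ
  ∑ f = ∑[ i < suc p ] f i

∑-off : ∀ {p} → Permutation′ (suc p) → (Fin (suc p) → Fin (suc p) → ℕ) → ℕ
∑-off {p} σ g = ∑[ i < suc p ] ∑[ s < p ] g i (punchIn (σ ⟨$⟩ʳ i) s)

∑-graph+∑-off : ∀ {p} (σ : Permutation′ (suc p)) g →
                ∑[ i < suc p ] g i (σ ⟨$⟩ʳ i) + ∑-off σ g ≡ ∑[ i < suc p ] ∑[ j < suc p ] g i j
∑-graph+∑-off {p} σ g = begin
  ∑[ i < suc p ] g i (σ ⟨$⟩ʳ i) + ∑-off σ g        ≡⟨ ∑-distrib-+ (λ i → g i (σ ⟨$⟩ʳ i)) off ⟨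
  ∑[ i < suc p ] (g i (σ ⟨$⟩ʳ i) + off i)          ≡⟨ sum-cong-≗ (λ i → ∑-punchIn (g i) (σ ⟨$⟩ʳ i)) ⟩
  ∑[ i < suc p ] ∑[ j < suc p ] g i j              ∎
  where
  open ≡-Reasoning
  off : Fin (suc p) → ℕ
  off i = ∑[ s < p ] g i (punchIn (σ ⟨$⟩ʳ i) s)

∑-off-flip : ∀ {p} (σ : Permutation′ (suc p)) g → ∑-off σ g ≡ ∑-off (Perm.flip σ) (λ j i → g i j)
∑-off-flip {p} σ g = +-cancelˡ-≡ (∑[ i < suc p ] g i (σ ⟨$⟩ʳ i)) _ _ (begin
  ∑[ i < suc p ] g i (σ ⟨$⟩ʳ i) + ∑-off σ g                    ≡⟨ ∑-graph+∑-off σ g ⟩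
  ∑[ i < suc p ] ∑[ j < suc p ] g i j                          ≡⟨ ∑-comm g ⟩
  ∑[ j < suc p ] ∑[ i < suc p ] g i j                          ≡⟨ ∑-graph+∑-off (Perm.flip σ) (λ j i → g i j) ⟨
  ∑[ j < suc p ] g (σ ⟨$⟩ˡ j) j + ∑-off (Perm.flip σ) (λ j i → g i j)
                                                               ≡⟨ cong (_+ ∑-off (Perm.flip σ) (λ j i → g i j)) graph-flip ⟨
  ∑[ i < suc p ] g i (σ ⟨$⟩ʳ i) + ∑-off (Perm.flip σ) (λ j i → g i j) ∎)
  where
  open ≡-Reasoning
  graph-flip : ∑[ i < suc p ] g i (σ ⟨$⟩ʳ i) ≡ ∑[ j < suc p ] g (σ ⟨$⟩ˡ j) j
  graph-flip = sym (trans (∑-permute (λ j → g (σ ⟨$⟩ˡ j) j) σ)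
                          (sum-cong-≗ {suc p} (λ i → cong (λ i′ → g i′ (σ ⟨$⟩ʳ i)) (Perm.inverseˡ σ {i}))))

rescale : ∀ {c x l y} d → c * x ≡ l * y → c * (d * x) ≡ d * l * y
rescale {c} {x} {l} {y} d cx≡ly = begin
  c * (d * x)  ≡⟨ x∙yz≈y∙xz c d x ⟩
  d * (c * x)  ≡⟨ cong (d *_) cx≡ly ⟩
  d * (l * y)  ≡⟨ *-assoc d l y ⟨
  d * l * y    ∎
  where open ≡-Reasoning

⟨$⟩ʳ-injective : ∀ {k} (π : Permutation′ k) {i j} → π ⟨$⟩ʳ i ≡ π ⟨$⟩ʳ j → i ≡ j
⟨$⟩ʳ-injective π {i} {j} πi≡πj = trans (sym (Perm.inverseˡ π)) (trans (cong (π ⟨$⟩ˡ_) πi≡πj) (Perm.inverseˡ π))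

matching⇒permutation : ∀ {k} (R : Fin k → Fin k → Set) → (∀ i j → Dec (R i j)) →
                       (∀ {i j j′} → R i j → R i j′ → j ≡ j′) →
                       (∀ {i i′ j} → R i j → R i′ j → i ≡ i′) →
                       Σ (Permutation′ k) λ π → ∀ {i j} → R i j → π ⟨$⟩ʳ i ≡ j
matching⇒permutation {zero}  R R? functional injective = Perm.id , λ { {()} }
matching⇒permutation {suc k} R R? functional injective with any? (λ i → any? (R? i))
... | no  ∄edge          = Perm.id , λ {i} {j} r → ⊥-elim (∄edge (i , j , r))
... | yes (i , j , rᵢⱼ) = Perm.insert i j π , extends
  where
  R′ : Fin k → Fin k → Set
  R′ s t = R (punchIn i s) (punchIn j t)

  restricted = matching⇒permutation R′ (λ s t → R? (punchIn i s) (punchIn j t))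
                 (λ r r′ → punchIn-injective j _ _ (functional r r′))
                 (λ r r′ → punchIn-injective i _ _ (injective r r′))
  π = proj₁ restricted

  -- By definition, Perm.insert i j π sends i to j and i′ ≢ i to punchIn j (π ⟨$⟩ʳ punchOut i≢i′).
  extends : ∀ {i′ j′} → R i′ j′ → Perm.insert i j π ⟨$⟩ʳ i′ ≡ j′
  extends {i′} {j′} r with i ≟ i′
  ... | yes refl = functional rᵢⱼ r
  ... | no i≢i′  = trans (cong (punchIn j) (proj₂ restricted r′)) (punchIn-punchOut j≢j′)
    where
    j≢j′ : j ≢ j′
    j≢j′ refl = i≢i′ (injective rᵢⱼ r)
    s = punchOut i≢i′
    t = punchOut j≢j′
    r′ : R′ s t
    r′ = subst₂ R (sym (punchIn-punchOut i≢i′)) (sym (punchIn-punchOut j≢j′)) r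

permutation₂-avoiding : ∀ {m} (x h : Fin 2 → Fin m) → x 0F ≢ x 1F → h 0F ≢ h 1F →
                        Σ (Permutation′ 2) λ β → ∀ s → x (β ⟨$⟩ʳ s) ≢ h s
permutation₂-avoiding x h x₀≢x₁ h₀≢h₁ with x 0F ≟ h 0F | x 1F ≟ h 1F
... | no x₀≢h₀ | no x₁≢h₁ = Perm.id , λ { 0F → x₀≢h₀ ; 1F → x₁≢h₁ }
... | yes x₀≡h₀ | _ = Perm.transpose 0F 1F ,
  λ { 0F x₁≡h₀ → x₀≢x₁ (trans x₀≡h₀ (sym x₁≡h₀)) ; 1F x₀≡h₁ → h₀≢h₁ (trans (sym x₀≡h₀) x₀≡h₁) }
... | no _ | yes x₁≡h₁ = Perm.transpose 0F 1F ,
  λ { 0F x₁≡h₀ → h₀≢h₁ (trans (sym x₁≡h₀) x₁≡h₁) ; 1F x₀≡h₁ → x₀≢x₁ (trans x₀≡h₁ (sym x₁≡h₁)) }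

∃-avoiding-two : ∀ {m} (x y : Fin (3 + m)) → ∃ λ c → c ≢ x × c ≢ y
∃-avoiding-two x y with punchIn x 0F ≟ y
... | no x₀≢y  = punchIn x 0F , punchInᵢ≢i x 0F , x₀≢y
... | yes x₀≡y = punchIn x 1F , punchInᵢ≢i x 1F ,
                 λ x₁≡y → 0≢1+n (punchIn-injective x 0F 1F (trans x₀≡y (sym x₁≡y)))

unique⇒length≤∣∣ : ∀ {n} {S : Subset n} {xs : List (Fin n)} → Unique xs → All (_∈ S) xs → length xs ≤ ∣ S ∣
unique⇒length≤∣∣ {xs = []}     _                   _              = z≤n
unique⇒length≤∣∣ {xs = x ∷ xs} (x≢xs ∷ unique-xs) (x∈S ∷ xs⊆S) = ≤-trans
  (s≤s (unique⇒length≤∣∣ unique-xs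
          (All.zipWith (λ (x≢y , y∈S) → x∈p∧x≢y⇒x∈p-y y∈S (≢-sym x≢y)) (x≢xs , xs⊆S))))
  (x∈p⇒∣p-x∣<∣p∣ x∈S)

least : ∀ {r} {P : Fin r → Set} → (∀ i → Dec (P i)) → ∃ P → Σ (Fin r) λ i → P i × (∀ {j} → P j → i Fin.≤ j)
least {suc r} P? ∃P with P? zero
... | yes P₀ = zero , P₀ , λ _ → z≤n
least {suc r} P? (zero  , P₀) | no ¬P₀ = ⊥-elim (¬P₀ P₀)
least {suc r} P? (suc i , Pᵢ) | no ¬P₀ with least (P? ∘ suc) (i , Pᵢ)
... | m , Pₘ , m-least = suc m , Pₘ , λ { {zero} P₀ → ⊥-elim (¬P₀ P₀) ; {suc j} Pⱼ → s≤s (m-least Pⱼ) }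

fromℕ : ℕ → ℚ
fromℕ n = ℤ.+ n ℚ./ 1

toℚᵘ-fromℕ : ∀ n → ℚ.toℚᵘ (fromℕ n) ≡ ℚᵘ.mkℚᵘ (ℤ.+ n) 0
toℚᵘ-fromℕ n = cong ℚ.toℚᵘ (ℚ.normalize-coprime (Coprime.sym (1-coprimeTo n)))

fromℕ-+ : ∀ m n → fromℕ (m + n) ≡ fromℕ m ℚ.+ fromℕ n
fromℕ-+ m n = ℚ.toℚᵘ-injective (begin
  ℚ.toℚᵘ (fromℕ (m + n))                     ≡⟨ toℚᵘ-fromℕ (m + n) ⟩
  ℚᵘ.mkℚᵘ (ℤ.+ (m + n)) 0                    ≈⟨ ℚᵘ.*≡* (trans (ℤ.*-identityʳ _) (trans (ℤ.pos-+ m n)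
                                                   (sym (trans (ℤ.*-identityʳ _)
                                                     (cong₂ ℤ._+_ (ℤ.*-identityʳ (ℤ.+ m)) (ℤ.*-identityʳ (ℤ.+ n))))))) ⟩
  ℚᵘ.mkℚᵘ (ℤ.+ m) 0 ℚᵘ.+ ℚᵘ.mkℚᵘ (ℤ.+ n) 0  ≡⟨ cong₂ ℚᵘ._+_ (toℚᵘ-fromℕ m) (toℚᵘ-fromℕ n) ⟨
  ℚ.toℚᵘ (fromℕ m) ℚᵘ.+ ℚ.toℚᵘ (fromℕ n)     ≈⟨ ℚ.toℚᵘ-homo-+ (fromℕ m) (fromℕ n) ⟨
  ℚ.toℚᵘ (fromℕ m ℚ.+ fromℕ n)               ∎)
  where open ℚᵘ.≃-Reasoning

fromℕ-* : ∀ m n → fromℕ (m * n) ≡ fromℕ m ℚ.* fromℕ n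
fromℕ-* m n = ℚ.toℚᵘ-injective (begin
  ℚ.toℚᵘ (fromℕ (m * n))                     ≡⟨ toℚᵘ-fromℕ (m * n) ⟩
  ℚᵘ.mkℚᵘ (ℤ.+ (m * n)) 0                    ≈⟨ ℚᵘ.*≡* (trans (ℤ.*-identityʳ _)
                                                   (trans (ℤ.pos-* m n) (sym (ℤ.*-identityʳ _)))) ⟩
  ℚᵘ.mkℚᵘ (ℤ.+ m) 0 ℚᵘ.* ℚᵘ.mkℚᵘ (ℤ.+ n) 0  ≡⟨ cong₂ ℚᵘ._*_ (toℚᵘ-fromℕ m) (toℚᵘ-fromℕ n) ⟨
  ℚ.toℚᵘ (fromℕ m) ℚᵘ.* ℚ.toℚᵘ (fromℕ n)     ≈⟨ ℚ.toℚᵘ-homo-* (fromℕ m) (fromℕ n) ⟨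
  ℚ.toℚᵘ (fromℕ m ℚ.* fromℕ n)               ∎)
  where open ℚᵘ.≃-Reasoning

module _ {n k : ℕ} {G : Graph n} (C : KFoldCover G k) where

  private
    weighted : ℚ → List (Transversal n k) → Distribution (Transversal n k)
    weighted w = map (w ,_)

    totalMass-weighted : ∀ w T → totalMass (weighted w T) ≡ fromℕ (length T) ℚ.* w
    totalMass-weighted w []      = sym (ℚ.*-zeroˡ w)
    totalMass-weighted w (t ∷ T) = begin
      w ℚ.+ totalMass (weighted w T)           ≡⟨ cong (w ℚ.+_) (totalMass-weighted w T) ⟩
      w ℚ.+ fromℕ (length T) ℚ.* w             ≡⟨ cong (ℚ._+ fromℕ (length T) ℚ.* w) (ℚ.*-identityˡ w) ⟨
      1ℚ ℚ.* w ℚ.+ fromℕ (length T) ℚ.* w      ≡⟨ ℚ.*-distribʳ-+ w 1ℚ (fromℕ (length T)) ⟨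
      (1ℚ ℚ.+ fromℕ (length T)) ℚ.* w          ≡⟨ cong (ℚ._* w) (fromℕ-+ 1 (length T)) ⟨
      fromℕ (suc (length T)) ℚ.* w             ∎
      where open ≡-Reasoning

    probHit-weighted : ∀ w T v x → probHit (weighted w T) v x ≡ fromℕ (∑[ t ∈ T ] indicator (t v ≟ x)) ℚ.* w
    probHit-weighted w []      v x = sym (ℚ.*-zeroˡ w)
    probHit-weighted w (t ∷ T) v x with t v ≟ x
    ... | no  _ = probHit-weighted w T v x
    ... | yes _ = begin
      w ℚ.+ probHit (weighted w T) v x         ≡⟨ cong (w ℚ.+_) (probHit-weighted w T v x) ⟩
      w ℚ.+ fromℕ c ℚ.* w                      ≡⟨ cong (ℚ._+ fromℕ c ℚ.* w) (ℚ.*-identityˡ w) ⟨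
      1ℚ ℚ.* w ℚ.+ fromℕ c ℚ.* w               ≡⟨ ℚ.*-distribʳ-+ w 1ℚ (fromℕ c) ⟨
      (1ℚ ℚ.+ fromℕ c) ℚ.* w                   ≡⟨ cong (ℚ._* w) (fromℕ-+ 1 c) ⟨
      fromℕ (suc c) ℚ.* w                      ∎
      where
      open ≡-Reasoning
      c = ∑[ t ∈ T ] indicator (t v ≟ x)

  uniformPacking : (T : List (Transversal n k)) (N : ℕ) → length T ≡ suc N →
                   All (IndependentTransversal C) T →
                   (∀ v x → k * ∑[ t ∈ T ] indicator (t v ≟ x) ≡ length T) →
                   FractionalPacking C
  uniformPacking T N |T|≡1+N independent uniform =
    weighted w T , entries independent , mass , hits
    where
    coprime = Coprime.sym (1-coprimeTo (suc N))
    |T| = mkℚ (ℤ.+ suc N) 0 coprime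
    w = 1/ |T|

    fromℕ|T|*w≡1 : fromℕ (length T) ℚ.* w ≡ 1ℚ
    fromℕ|T|*w≡1 = trans (cong (λ m → fromℕ m ℚ.* w) |T|≡1+N)
                     (trans (cong (ℚ._* w) (ℚ.normalize-coprime coprime)) (ℚ.*-inverseʳ |T|))

    entries : ∀ {T} → All (IndependentTransversal C) T →
              AllEntries (λ w t → (0ℚ ℚ.≤ w) × IndependentTransversal C t) (weighted w T)
    entries []       = []
    entries (i ∷ is) = (ℚ.nonNegative⁻¹ w {{ℚ.pos⇒nonNeg w {{ℚ.1/pos⇒pos |T|}}}} , i) ∷ entries is

    mass : totalMass (weighted w T) ≡ 1ℚ
    mass = trans (totalMass-weighted w T) fromℕ|T|*w≡1

    hits : ∀ v x → 1ℚ ℚ.≤ (ℤ.+ k ℚ./ 1) ℚ.* probHit (weighted w T) v x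
    hits v x = ℚ.≤-reflexive (sym (begin
      fromℕ k ℚ.* probHit (weighted w T) v x  ≡⟨ cong (fromℕ k ℚ.*_) (probHit-weighted w T v x) ⟩
      fromℕ k ℚ.* (fromℕ c ℚ.* w)             ≡⟨ ℚ.*-assoc (fromℕ k) _ w ⟨
      fromℕ k ℚ.* fromℕ c ℚ.* w               ≡⟨ cong (ℚ._* w) (fromℕ-* k c) ⟨
      fromℕ (k * c) ℚ.* w                     ≡⟨ cong (λ m → fromℕ m ℚ.* w) (uniform v x) ⟩
      fromℕ (length T) ℚ.* w                  ≡⟨ fromℕ|T|*w≡1 ⟩
      1ℚ                                      ∎))
      where
      open ≡-Reasoning
      c = ∑[ t ∈ T ] indicator (t v ≟ x)

module Ordering {n : ℕ} {G : Graph n} (D : PathDecomposition G) where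

  firstBag : Fin n → Fin (r D)
  firstBag v = proj₁ (least (λ i → v ∈? bag D i) (covers-v D v))

  ∈-firstBag : ∀ v → v ∈ bag D (firstBag v)
  ∈-firstBag v = proj₁ (proj₂ (least (λ i → v ∈? bag D i) (covers-v D v)))

  firstBag-least : ∀ {v i} → v ∈ bag D i → firstBag v Fin.≤ i
  firstBag-least {v} = proj₂ (proj₂ (least (λ i → v ∈? bag D i) (covers-v D v)))

  key : Fin n → ℕ
  key v = toℕ (firstBag v) * n + toℕ v

  private
    key<next : ∀ v → key v < suc (toℕ (firstBag v)) * n
    key<next v = subst (key v <_) (+-comm (toℕ (firstBag v) * n) n) (+-monoʳ-< (toℕ (firstBag v) * n) (toℕ<n v))

  key<r*n : ∀ v → key v < r D * n
  key<r*n v = <-≤-trans (key<next v) (*-monoˡ-≤ n (toℕ<n (firstBag v)))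

  firstBag<⇒key< : ∀ u v → firstBag u Fin.< firstBag v → key u < key v
  firstBag<⇒key< u v fu<fv = <-≤-trans (key<next u) (≤-trans (*-monoˡ-≤ n fu<fv) (m≤m+n _ (toℕ v)))

  key<⇒firstBag≤ : ∀ {u v} → key u < key v → firstBag u Fin.≤ firstBag v
  key<⇒firstBag≤ {u} {v} ku<kv = ≮⇒≥ (λ fv<fu → <-asym ku<kv (firstBag<⇒key< v u fv<fu))

  key-injective : ∀ {u v} → key u ≡ key v → u ≡ v
  key-injective {u} {v} ku≡kv with <-cmp (toℕ (firstBag u)) (toℕ (firstBag v))
  ... | tri< fu<fv _ _ = ⊥-elim (<-irrefl ku≡kv (firstBag<⇒key< u v fu<fv))
  ... | tri> _ _ fv<fu = ⊥-elim (<-irrefl (sym ku≡kv) (firstBag<⇒key< v u fv<fu))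
  ... | tri≈ _ fu≡fv _ = toℕ-injective (+-cancelˡ-≡ (toℕ (firstBag u) * n) _ _
                           (trans ku≡kv (cong (λ f → f * n + toℕ v) (sym fu≡fv))))

  key<⇒≢ : ∀ {u v} → key u < key v → u ≢ v
  key<⇒≢ ku<kv refl = <-irrefl refl ku<kv

  processed-split : ∀ {u v} → key u < suc (key v) → key u < key v ⊎ u ≡ v
  processed-split ku<1+kv with m≤n⇒m<n∨m≡n (s≤s⁻¹ ku<1+kv)
  ... | inj₁ ku<m = inj₁ ku<m
  ... | inj₂ ku≡m = inj₂ (key-injective ku≡m)

  earlier-∈-firstBag : ∀ {u v i} → key u < key v → u ∈ bag D i → firstBag v Fin.≤ i → u ∈ bag D (firstBag v)
  earlier-∈-firstBag {u} {v} {i} ku<kv u∈i fv≤i =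
    interval D u (firstBag u) (firstBag v) i (key<⇒firstBag≤ ku<kv) fv≤i (∈-firstBag u) u∈i

  Mate : Fin n → Fin n → Set
  Mate v u = key u < key v × u ∈ bag D (firstBag v)

  mate? : ∀ v u → Dec (Mate v u)
  mate? v u = (key u <? key v) ×-dec (u ∈? bag D (firstBag v))

  mates : Fin n → List (Fin n)
  mates v = filter (mate? v) (allFin n)

  ∈-mates⁺ : ∀ {v u} → Mate v u → u ∈ₗ mates v
  ∈-mates⁺ {v} {u} = ∈-filter⁺ (mate? v) (∈-allFin u)

  ∈-mates⁻ : ∀ {v u} → u ∈ₗ mates v → Mate v u
  ∈-mates⁻ {v} u∈mates = proj₂ (∈-filter⁻ (mate? v) {xs = allFin n} u∈mates)

  mates-unique : ∀ v → Unique (mates v)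
  mates-unique v = Unique.filter⁺ (mate? v) (Unique.allFin⁺ n)

  length-mates : ∀ {p} → WidthAtMost D p → ∀ v → length (mates v) ≤ p
  length-mates W v = s≤s⁻¹ (≤-trans
    (unique⇒length≤∣∣ (v≢mates ∷ mates-unique v) (∈-firstBag v ∷ mates⊆bag)) (W (firstBag v)))
    where
    v≢mates : All (v ≢_) (mates v)
    v≢mates = All.tabulate (λ u∈mates → ≢-sym (key<⇒≢ (proj₁ (∈-mates⁻ u∈mates))))
    mates⊆bag : All (_∈ bag D (firstBag v)) (mates v)
    mates⊆bag = All.tabulate (proj₂ ∘ ∈-mates⁻)

  neighbour⇒mate : ∀ {u v} → adj G u v ≡ true → key u < key v → Mate v u
  neighbour⇒mate {u} {v} uv∈E ku<kv with covers-e D u v uv∈E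
  ... | i , u∈i , v∈i = ku<kv , earlier-∈-firstBag ku<kv u∈i (firstBag-least v∈i)

  CoMates : Fin n → Fin n → Set
  CoMates u w = ∃ λ d → Mate d u × Mate d w × u ≢ w

  coMates-sym : ∀ {u w} → CoMates u w → CoMates w u
  coMates-sym (d , mu , mw , u≢w) = d , mw , mu , ≢-sym u≢w

  coMates⇒mate : ∀ {u v} → CoMates u v → key u < key v → Mate v u
  coMates⇒mate (d , (_ , u∈d) , (_ , v∈d) , _) ku<kv = ku<kv , earlier-∈-firstBag ku<kv u∈d (firstBag-least v∈d)

  coMates? : ∀ u w → Dec (CoMates u w)
  coMates? u w = any? (λ d → mate? d u ×-dec mate? d w ×-dec ¬? (u ≟ w))

  private
    four-in-firstBag : WidthAtMost D 2 → ∀ {v a b d₁ d₂} → Mate v a → Mate v b → a ≢ b →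
                       Mate d₁ a → Mate d₁ v → Mate d₂ b → firstBag d₁ Fin.≤ firstBag d₂ → ⊥
    four-in-firstBag W {v} {a} {b} {d₁} {d₂} (a<v , _) (b<v , b∈v) a≢b (a<d₁ , a∈d₁) (v<d₁ , v∈d₁) (_ , b∈d₂) f₁≤f₂ =
      <-irrefl refl (≤-trans (unique⇒length≤∣∣ distinct (a∈d₁ ∷ b∈d₁ ∷ v∈d₁ ∷ ∈-firstBag d₁ ∷ []))
                             (W (firstBag d₁)))
      where
      b∈d₁ : b ∈ bag D (firstBag d₁)
      b∈d₁ = interval D b (firstBag v) (firstBag d₁) (firstBag d₂) (firstBag-least v∈d₁) f₁≤f₂ b∈v b∈d₂
      distinct : Unique (a ∷ b ∷ v ∷ d₁ ∷ [])
      distinct = (a≢b ∷ key<⇒≢ a<v ∷ key<⇒≢ a<d₁ ∷ [])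
               ∷ (key<⇒≢ b<v ∷ key<⇒≢ (<-trans b<v v<d₁) ∷ [])
               ∷ (key<⇒≢ v<d₁ ∷ [])
               ∷ [] ∷ []

  coMates-exclusive : WidthAtMost D 2 → ∀ {v a b} → Mate v a → Mate v b → a ≢ b → CoMates a v → CoMates b v → ⊥
  coMates-exclusive W ma mb a≢b (d₁ , a-d₁ , v-d₁ , _) (d₂ , b-d₂ , v-d₂ , _)
    with ≤-total (toℕ (firstBag d₁)) (toℕ (firstBag d₂))
  ... | inj₁ f₁≤f₂ = four-in-firstBag W ma mb a≢b a-d₁ v-d₁ b-d₂ f₁≤f₂
  ... | inj₂ f₂≤f₁ = four-in-firstBag W mb ma (≢-sym a≢b) b-d₂ v-d₂ a-d₁ f₂≤f₁

  data MatesView (v : Fin n) : ℕ → Set where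
    none : (∀ {u} → ¬ Mate v u) → MatesView v 0
    one  : ∀ {a} → Mate v a → (∀ {u} → Mate v u → u ≡ a) → MatesView v 1
    two  : ∀ {a b} → Mate v a → Mate v b → a ≢ b → (∀ {u} → Mate v u → u ≡ a ⊎ u ≡ b) → MatesView v 2
    many : ∀ {c} → MatesView v (3 + c)

  matesView : ∀ v → MatesView v (length (mates v))
  matesView v with mates v | (λ {u} → ∈-mates⁻ {v} {u}) | (λ {u} → ∈-mates⁺ {v} {u}) | mates-unique v
  ... | []            | _     | complete | _ = none (λ m → case complete m of λ ())
  ... | a ∷ []        | sound | complete | _ =
    one (sound (here refl)) (λ m → case complete m of λ { (here u≡a) → u≡a })
  ... | a ∷ b ∷ []    | sound | complete | (a≢b ∷ []) ∷ _ =
    two (sound (here refl)) (sound (there (here refl))) a≢b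
        (λ m → case complete m of λ { (here u≡a) → inj₁ u≡a ; (there (here u≡b)) → inj₂ u≡b })
  ... | _ ∷ _ ∷ _ ∷ _ | _     | _        | _ = many

module Elimination {n p : ℕ} {G : Graph n} (D : PathDecomposition G) (C : KFoldCover G (suc p)) where

  open Ordering D

  Colouring : Set
  Colouring = Transversal n (suc p)

  recolour : Colouring → Fin n → Fin (suc p) → Colouring
  recolour t v c = updateAt t v (λ _ → c)

  recolour-at : ∀ t v c → recolour t v c v ≡ c
  recolour-at t v c = updateAt-updates v t

  recolour-elsewhere : ∀ t {v} c {u} → u ≢ v → recolour t v c u ≡ t u
  recolour-elsewhere t {v} c {u} u≢v = updateAt-minimal u v t u≢v

  extend : ∀ {d} → Fin n → (Colouring → Fin d → Fin (suc p)) → List Colouring → List Colouring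
  extend v K = concatMap (λ t → tabulate (recolour t v ∘ K t))

  -- T is read as the uniform distribution on its members: UniformAt says that t u is uniform,
  -- CoupledOff σ that (t u , t w) is uniform on the pairs (i , j) with j ≢ σ i.
  UniformAt : Fin n → List Colouring → Set
  UniformAt u T = ∀ (g : Fin (suc p) → ℕ) → suc p * ∑[ t ∈ T ] g (t u) ≡ length T * ∑[ i < suc p ] g i

  CoupledOff : Permutation′ (suc p) → Fin n → Fin n → List Colouring → Set
  CoupledOff σ u w T = ∀ (g : Fin (suc p) → Fin (suc p) → ℕ) →
                       suc p * p * ∑[ t ∈ T ] g (t u) (t w) ≡ length T * ∑-off σ g

  coupledOff-flip : ∀ {σ u w T} → CoupledOff σ u w T → CoupledOff (Perm.flip σ) w u T
  coupledOff-flip {σ} {T = T} coupled g = trans (coupled (λ i j → g j i)) (cong (length T *_) (∑-off-flip σ (λ i j → g j i)))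

  coupledOff⇒uniformAt : .{{NonZero p}} → ∀ {σ u w T} → CoupledOff σ u w T → UniformAt w T
  coupledOff⇒uniformAt {σ} {u} {w} {T} coupled g = *-cancelˡ-≡ _ _ p (begin
    p * (suc p * ∑ₜ)              ≡⟨ x∙yz≈y∙xz p (suc p) ∑ₜ ⟩
    suc p * (p * ∑ₜ)              ≡⟨ *-assoc (suc p) p ∑ₜ ⟨
    suc p * p * ∑ₜ                ≡⟨ coupled (λ _ j → g j) ⟩
    length T * ∑-off σ (λ _ j → g j) ≡⟨ cong (length T *_) (∑-punchIn-permute σ g) ⟩
    length T * (p * ∑g)           ≡⟨ x∙yz≈y∙xz (length T) p ∑g ⟩
    p * (length T * ∑g)           ∎)
    where
    open ≡-Reasoning
    ∑ₜ = ∑[ t ∈ T ] g (t w)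
    ∑g = ∑[ i < suc p ] g i

  module _ {d} (v : Fin n) (K : Colouring → Fin d → Fin (suc p)) (T : List Colouring) where

    ∑-extend : ∀ f → ∑[ t ∈ extend v K T ] f t ≡ ∑[ t ∈ T ] ∑[ s < d ] f (recolour t v (K t s))
    ∑-extend f = trans (∑ₗ-concatMap (λ t → tabulate (recolour t v ∘ K t)) T f)
                       (∑ₗ-cong T (λ t → ∑ₗ-tabulate (recolour t v ∘ K t) f))

    ∑-extend-unchanged : ∀ f → (∀ t c → f (recolour t v c) ≡ f t) → ∑[ t ∈ extend v K T ] f t ≡ d * ∑[ t ∈ T ] f t
    ∑-extend-unchanged f unchanged = begin
      ∑[ t ∈ extend v K T ] f t                       ≡⟨ ∑-extend f ⟩
      ∑[ t ∈ T ] ∑[ s < d ] f (recolour t v (K t s))  ≡⟨ ∑ₗ-cong T (λ t → sum-cong-≗ (λ s → unchanged t (K t s))) ⟩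
      ∑[ t ∈ T ] ∑[ s < d ] f t                       ≡⟨ ∑ₗ-cong T (λ t → ∑-const d (f t)) ⟩
      ∑[ t ∈ T ] (d * f t)                            ≡⟨ ∑ₗ-*ˡ T d f ⟩
      d * ∑[ t ∈ T ] f t                              ∎
      where open ≡-Reasoning

    length-extend : length (extend v K T) ≡ d * length T
    length-extend = begin
      length (extend v K T)          ≡⟨ length≡∑1 (extend v K T) ⟩
      ∑[ t ∈ extend v K T ] 1        ≡⟨ ∑-extend-unchanged (λ _ → 1) (λ _ _ → refl) ⟩
      d * ∑[ t ∈ T ] 1               ≡⟨ cong (d *_) (length≡∑1 T) ⟨
      d * length T                   ∎
      where open ≡-Reasoning

    ∑-extend-new : ∀ f → ∑[ t ∈ extend v K T ] f (t v) ≡ ∑[ t ∈ T ] ∑[ s < d ] f (K t s)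
    ∑-extend-new f = trans (∑-extend (λ t → f (t v)))
      (∑ₗ-cong T (λ t → sum-cong-≗ (λ s → cong f (recolour-at t v (K t s)))))

    ∑-extend-pair : ∀ {u} → u ≢ v → ∀ f →
                    ∑[ t ∈ extend v K T ] f (t u) (t v) ≡ ∑[ t ∈ T ] ∑[ s < d ] f (t u) (K t s)
    ∑-extend-pair {u} u≢v f = trans (∑-extend (λ t → f (t u) (t v)))
      (∑ₗ-cong T (λ t → sum-cong-≗ (λ s → cong₂ f (recolour-elsewhere t (K t s) u≢v) (recolour-at t v (K t s)))))

    uniformAt-extend : ∀ {u} → u ≢ v → UniformAt u T → UniformAt u (extend v K T)
    uniformAt-extend {u} u≢v uniform g = begin
      suc p * ∑[ t ∈ extend v K T ] g (t u)    ≡⟨ cong (suc p *_) (∑-extend-unchanged (λ t → g (t u))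
                                                    (λ t c → cong g (recolour-elsewhere t c u≢v))) ⟩
      suc p * (d * ∑[ t ∈ T ] g (t u))         ≡⟨ rescale {suc p} {∑[ t ∈ T ] g (t u)} d (uniform g) ⟩
      d * length T * ∑[ i < suc p ] g i        ≡⟨ cong (_* ∑[ i < suc p ] g i) length-extend ⟨
      length (extend v K T) * ∑[ i < suc p ] g i ∎
      where open ≡-Reasoning

    coupledOff-extend : ∀ {σ u w} → u ≢ v → w ≢ v → CoupledOff σ u w T → CoupledOff σ u w (extend v K T)
    coupledOff-extend {σ} {u} {w} u≢v w≢v coupled g = begin
      suc p * p * ∑[ t ∈ extend v K T ] g (t u) (t w)   ≡⟨ cong (suc p * p *_) (∑-extend-unchanged (λ t → g (t u) (t w))
                                                             (λ t c → cong₂ g (recolour-elsewhere t c u≢v) (recolour-elsewhere t c w≢v))) ⟩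
      suc p * p * (d * ∑[ t ∈ T ] g (t u) (t w))        ≡⟨ rescale {suc p * p} {∑[ t ∈ T ] g (t u) (t w)} d (coupled g) ⟩
      d * length T * ∑-off σ g                          ≡⟨ cong (_* ∑-off σ g) length-extend ⟨
      length (extend v K T) * ∑-off σ g                 ∎
      where open ≡-Reasoning

    All-extend : ∀ {P Q : Colouring → Set} → All Q T → (∀ {t} → Q t → ∀ s → P (recolour t v (K t s))) →
                 All P (extend v K T)
    All-extend qs h = concat⁺ (map⁺ (All.map (λ q → tabulate⁺ (h q)) qs))

  IndependentBelow : ℕ → Colouring → Set
  IndependentBelow m t = ∀ u w → key u < m → key w < m → E C u (t u) w (t w) ≡ false

  module _ {v : Fin n} {t : Colouring} {c : Fin (suc p)} (avoids : ∀ {u} → Mate v u → E C u (t u) v c ≡ false) where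

    earlier-avoids : ∀ {u} → key u < key v → E C u (t u) v c ≡ false
    earlier-avoids {u} ku<kv with adj G u v in uv
    ... | true  = avoids (neighbour⇒mate uv ku<kv)
    ... | false = nonadj C u v (t u) c (key<⇒≢ ku<kv) uv

    independentBelow-recolour : IndependentBelow (key v) t → IndependentBelow (suc (key v)) (recolour t v c)
    independentBelow-recolour independent u w ku kw with processed-split ku | processed-split kw
    ... | inj₁ ku<kv | inj₁ kw<kv
      rewrite recolour-elsewhere t c (key<⇒≢ ku<kv) | recolour-elsewhere t c (key<⇒≢ kw<kv)
      = independent u w ku<kv kw<kv
    ... | inj₁ ku<kv | inj₂ refl
      rewrite recolour-elsewhere t c (key<⇒≢ ku<kv) | recolour-at t v c
      = earlier-avoids ku<kv
    ... | inj₂ refl | inj₁ kw<kv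
      rewrite recolour-at t v c | recolour-elsewhere t c (key<⇒≢ kw<kv)
      = trans (E-sym C v c w (t w)) (earlier-avoids kw<kv)
    ... | inj₂ refl | inj₂ refl
      rewrite recolour-at t v c
      = E-irr C v c

  record Invariant (m : ℕ) (T : List Colouring) : Set where
    field
      nonempty    : NonZero (length T)
      independent : All (IndependentBelow m) T
      uniform     : ∀ {u} → key u < m → UniformAt u T
      coupled     : ∀ {u w} → key u < key w → key w < m → CoMates u w → ∃ λ σ → CoupledOff σ u w T

    coupled-anyOrder : ∀ {u w} → key u < m → key w < m → CoMates u w → ∃ λ σ → CoupledOff σ u w T
    coupled-anyOrder {u} {w} ku kw uw with <-cmp (key u) (key w)
    ... | tri< ku<kw _ _ = coupled ku<kw kw uw
    ... | tri≈ _ ku≡kw _ = ⊥-elim (proj₂ (proj₂ (proj₂ uw)) (key-injective ku≡kw))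
    ... | tri> _ _ kw<ku = let σ , coupledOff = coupled kw<ku ku (coMates-sym uw) in
                           Perm.flip σ , coupledOff-flip {σ} {w} {u} {T} coupledOff

  module _ {T} (v : Fin n) (inv : Invariant (key v) T) {d} .{{d≢0 : NonZero d}} (K : Colouring → Fin d → Fin (suc p)) where

    open Invariant inv

    assemble : (∀ t s {u} → Mate v u → E C u (t u) v (K t s) ≡ false) →
               (∀ {u} → Mate v u → CoMates u v → ∃ λ σ → CoupledOff σ u v (extend v K T)) →
               UniformAt v (extend v K T) →
               Invariant (suc (key v)) (extend v K T)
    assemble avoids coupled-v uniform-v = record
      { nonempty    = subst NonZero (sym (length-extend v K T)) (m*n≢0 d (length T) {{d≢0}} {{nonempty}})
      ; independent = All-extend v K T independent (λ {t} ind s → independentBelow-recolour (avoids t s) ind)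
      ; uniform     = uniform-extended
      ; coupled     = coupled-extended
      }
      where
      uniform-extended : ∀ {u} → key u < suc (key v) → UniformAt u (extend v K T)
      uniform-extended ku with processed-split ku
      ... | inj₁ ku<kv = uniformAt-extend v K T (key<⇒≢ ku<kv) (uniform ku<kv)
      ... | inj₂ refl  = uniform-v

      coupled-extended : ∀ {u w} → key u < key w → key w < suc (key v) → CoMates u w →
                         ∃ λ σ → CoupledOff σ u w (extend v K T)
      coupled-extended ku<kw kw uw with processed-split kw
      ... | inj₁ kw<kv = let σ , coupledOff = coupled ku<kw kw<kv uw in
                         σ , coupledOff-extend v K T {σ} (key<⇒≢ (<-trans ku<kw kw<kv)) (key<⇒≢ kw<kv) coupledOff
      ... | inj₂ refl  = coupled-v (coMates⇒mate uw ku<kw) uw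

  Extender : Set
  Extender = ∀ {T} v → Invariant (key v) T → ∃ (Invariant (suc (key v)))

  build : Extender → ∀ m → ∃ (Invariant m)
  build extender zero = (λ _ → zero) ∷ [] , record
    { nonempty = _ ; independent = (λ _ _ ()) ∷ [] ; uniform = λ () ; coupled = λ _ () }
  build extender (suc m) with build extender m | any? (λ v → key v ℕ.≟ m)
  ... | T , inv | yes (v , refl) = extender v inv
  ... | T , inv | no ∄v = T , record
    { nonempty    = nonempty
    ; independent = All.map (λ ind u w ku kw → ind u w (below ku) (below kw)) independent
    ; uniform     = uniform ∘ below
    ; coupled     = λ ku<kw kw → coupled ku<kw (below kw)
    }
    where
    open Invariant inv
    below : ∀ {u} → key u < suc m → key u < m
    below {u} ku = ≤∧≢⇒< (s≤s⁻¹ ku) (λ ku≡m → ∄v (u , ku≡m))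

  packing : Extender → FractionalPacking C
  packing extender with build extender (r D * n)
  ... | T , inv = uniformPacking C T (ℕ.pred (length T)) (sym (suc-pred (length T) {{nonempty}}))
    (All.map (λ ind u w → ind u w (key<r*n u) (key<r*n w)) independent)
    (λ v x → trans (uniform (key<r*n v) (λ i → indicator (i ≟ x)))
                   (trans (cong (length T *_) (∑-indicator x)) (*-identityʳ (length T))))
    where open Invariant inv

  matchingPermutation : ∀ {a v} → a ≢ v →
                        Σ (Permutation′ (suc p)) λ ρ → ∀ {i j} → E C a i v j ≡ true → ρ ⟨$⟩ʳ i ≡ j
  matchingPermutation {a} {v} a≢v = matching⇒permutation (λ i j → E C a i v j ≡ true) (λ i j → E C a i v j Bool.≟ true)
    (λ {i} {j} {j′} → matching C a v i j j′ a≢v)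
    (λ {i} {i′} {j} r r′ → matching C v a j i i′ (≢-sym a≢v) (trans (E-sym C v j a i) r) (trans (E-sym C v j a i′) r′))

  avoids-permutation : ∀ {a v ρ} → (∀ {i j} → E C a i v j ≡ true → ρ ⟨$⟩ʳ i ≡ j) →
                       ∀ {i c} → c ≢ ρ ⟨$⟩ʳ i → E C a i v c ≡ false
  avoids-permutation extends c≢ρi = ¬-not (λ e → c≢ρi (sym (extends e)))

  step-noMate : ∀ {T} v → (∀ {u} → ¬ Mate v u) → Invariant (key v) T → ∃ (Invariant (suc (key v)))
  step-noMate {T} v no-mates inv = _ , assemble v inv all-colours
    (λ _ _ m → ⊥-elim (no-mates m)) (λ m _ → ⊥-elim (no-mates m)) uniform-v
    where
    all-colours : Colouring → Fin (suc p) → Fin (suc p)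
    all-colours _ c = c

    uniform-v : UniformAt v (extend v all-colours T)
    uniform-v g = begin
      suc p * ∑[ t ∈ extend v all-colours T ] g (t v) ≡⟨ cong (suc p *_) (∑-extend-new v all-colours T g) ⟩
      suc p * ∑[ t ∈ T ] ∑g                          ≡⟨ cong (suc p *_) (∑ₗ-const T ∑g) ⟩
      suc p * (length T * ∑g)                        ≡⟨ *-assoc (suc p) (length T) ∑g ⟨
      suc p * length T * ∑g                          ≡⟨ cong (_* ∑g) (length-extend v all-colours T) ⟨
      length (extend v all-colours T) * ∑g           ∎
      where
      open ≡-Reasoning
      ∑g = ∑[ c < suc p ] g c

  step-oneMate : .{{NonZero p}} → ∀ {T a} v → Mate v a → (∀ {u} → Mate v u → u ≡ a) →
                 Invariant (key v) T → ∃ (Invariant (suc (key v)))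
  step-oneMate {T} {a} v (a<v , _) only-a inv =
    _ , assemble v inv K avoids coupled-v (coupledOff⇒uniformAt {ρ} {a} {v} {extend v K T} coupled-av)
    where
    open Invariant inv
    ρ-extends = matchingPermutation (key<⇒≢ a<v)
    ρ = proj₁ ρ-extends

    K : Colouring → Fin p → Fin (suc p)
    K t = punchIn (ρ ⟨$⟩ʳ t a)

    avoids : ∀ t s {u} → Mate v u → E C u (t u) v (K t s) ≡ false
    avoids t s mu with only-a mu
    ... | refl = avoids-permutation {ρ = ρ} (proj₂ ρ-extends) (punchInᵢ≢i (ρ ⟨$⟩ʳ t a) s)

    coupled-av : CoupledOff ρ a v (extend v K T)
    coupled-av g = begin
      suc p * p * ∑[ t ∈ extend v K T ] g (t a) (t v)  ≡⟨ cong (suc p * p *_) (∑-extend-pair v K T (key<⇒≢ a<v) g) ⟩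
      suc p * p * ∑ₜ                                   ≡⟨ *-assoc (suc p) p ∑ₜ ⟩
      suc p * (p * ∑ₜ)                                 ≡⟨ rescale {suc p} {∑ₜ} p (uniform a<v avoiding) ⟩
      p * length T * ∑-off ρ g                         ≡⟨ cong (_* ∑-off ρ g) (length-extend v K T) ⟨
      length (extend v K T) * ∑-off ρ g                ∎
      where
      open ≡-Reasoning
      avoiding : Fin (suc p) → ℕ
      avoiding i = ∑[ s < p ] g i (punchIn (ρ ⟨$⟩ʳ i) s)
      ∑ₜ = ∑[ t ∈ T ] avoiding (t a)

    coupled-v : ∀ {u} → Mate v u → CoMates u v → ∃ λ σ → CoupledOff σ u v (extend v K T)
    coupled-v mu _ with only-a mu
    ... | refl = ρ , coupled-av

  extender≤1 : p ≤ 1 → WidthAtMost D p → Extender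
  extender≤1 p≤1 W v inv with length (mates v) | matesView v | length-mates W v
  ... | _ | none no-mates  | _   = step-noMate v no-mates inv
  ... | _ | one ma only-a  | 1≤p = step-oneMate {{>-nonZero 1≤p}} v ma only-a inv
  ... | _ | two _ _ _ _    | 2≤p = case ≤-trans 2≤p p≤1 of λ { (s≤s ()) }
  ... | _ | many           | 3≤p = case ≤-trans 3≤p p≤1 of λ { (s≤s ()) }

module NewColour (σ ρ₁ ρ₂ : Permutation′ 3) where

  private
    avoiding : ∀ i → Σ (Permutation′ 2) λ β →
               ∀ s → punchIn (ρ₁ ⟨$⟩ʳ i) (β ⟨$⟩ʳ s) ≢ ρ₂ ⟨$⟩ʳ punchIn (σ ⟨$⟩ʳ i) s
    avoiding i = permutation₂-avoiding (punchIn (ρ₁ ⟨$⟩ʳ i)) (λ s → ρ₂ ⟨$⟩ʳ punchIn (σ ⟨$⟩ʳ i) s)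
      (0≢1+n ∘ punchIn-injective (ρ₁ ⟨$⟩ʳ i) 0F 1F)
      (0≢1+n ∘ punchIn-injective (σ ⟨$⟩ʳ i) 0F 1F ∘ ⟨$⟩ʳ-injective ρ₂)

    β : Fin 3 → Permutation′ 2
    β i = proj₁ (avoiding i)

  -- A pair (i , σ i) has probability zero; there any colour avoiding both constraints will do.
  colour : Fin 3 → Fin 3 → Fin 3
  colour i j with σ ⟨$⟩ʳ i ≟ j
  ... | yes _   = proj₁ (∃-avoiding-two (ρ₁ ⟨$⟩ʳ i) (ρ₂ ⟨$⟩ʳ j))
  ... | no σi≢j = punchIn (ρ₁ ⟨$⟩ʳ i) (β i ⟨$⟩ʳ punchOut σi≢j)

  colour-avoids : ∀ i j → colour i j ≢ ρ₁ ⟨$⟩ʳ i × colour i j ≢ ρ₂ ⟨$⟩ʳ j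
  colour-avoids i j with σ ⟨$⟩ʳ i ≟ j
  ... | yes _   = proj₂ (∃-avoiding-two (ρ₁ ⟨$⟩ʳ i) (ρ₂ ⟨$⟩ʳ j))
  ... | no σi≢j = punchInᵢ≢i (ρ₁ ⟨$⟩ʳ i) _ ,
                  subst (λ j′ → punchIn (ρ₁ ⟨$⟩ʳ i) (β i ⟨$⟩ʳ punchOut σi≢j) ≢ ρ₂ ⟨$⟩ʳ j′)
                        (punchIn-punchOut σi≢j) (proj₂ (avoiding i) (punchOut σi≢j))

  colour-punchIn : ∀ i s → colour i (punchIn (σ ⟨$⟩ʳ i) s) ≡ punchIn (ρ₁ ⟨$⟩ʳ i) (β i ⟨$⟩ʳ s)
  colour-punchIn i s with σ ⟨$⟩ʳ i ≟ punchIn (σ ⟨$⟩ʳ i) s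
  ... | yes σi≡ = ⊥-elim (punchInᵢ≢i (σ ⟨$⟩ʳ i) s (sym σi≡))
  ... | no _    = cong (λ s′ → punchIn (ρ₁ ⟨$⟩ʳ i) (β i ⟨$⟩ʳ s′))
                       (trans (punchOut-cong (σ ⟨$⟩ʳ i) refl) (punchOut-punchIn (σ ⟨$⟩ʳ i)))

  ∑-off-colour : ∀ h → ∑-off σ (λ i j → h i (colour i j)) ≡ ∑-off ρ₁ h
  ∑-off-colour h = sum-cong-≗ (λ i → begin
    ∑[ s < 2 ] h i (colour i (punchIn (σ ⟨$⟩ʳ i) s))   ≡⟨ sum-cong-≗ (λ s → cong (h i) (colour-punchIn i s)) ⟩
    ∑[ s < 2 ] h i (punchIn (ρ₁ ⟨$⟩ʳ i) (β i ⟨$⟩ʳ s))  ≡⟨ ∑-permute (λ s → h i (punchIn (ρ₁ ⟨$⟩ʳ i) s)) (β i) ⟨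
    ∑[ s < 2 ] h i (punchIn (ρ₁ ⟨$⟩ʳ i) s)              ∎)
    where open ≡-Reasoning

module WidthTwo {n : ℕ} {G : Graph n} (D : PathDecomposition G) (W : WidthAtMost D 2) (C : KFoldCover G 3) where

  open Ordering D
  open Elimination D C

  step-twoMates : ∀ {T a b} v → Mate v a → Mate v b → a ≢ b → (∀ {u} → Mate v u → u ≡ a ⊎ u ≡ b) →
                  ¬ CoMates b v → Invariant (key v) T → ∃ (Invariant (suc (key v)))
  step-twoMates {T} {a} {b} v ma@(a<v , _) mb@(b<v , _) a≢b only-ab ¬bv inv =
    _ , assemble v inv K avoids coupled-v (coupledOff⇒uniformAt {ρ₁} {a} {v} {extend v K T} coupled-av)
    where
    open Invariant inv
    coupled-ab = coupled-anyOrder a<v b<v (v , ma , mb , a≢b)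
    σ = proj₁ coupled-ab
    ρ₁-extends = matchingPermutation (key<⇒≢ a<v)
    ρ₂-extends = matchingPermutation (key<⇒≢ b<v)
    ρ₁ = proj₁ ρ₁-extends
    ρ₂ = proj₁ ρ₂-extends
    open NewColour σ ρ₁ ρ₂

    K : Colouring → Fin 1 → Fin 3
    K t _ = colour (t a) (t b)

    avoids : ∀ t s {u} → Mate v u → E C u (t u) v (K t s) ≡ false
    avoids t _ mu with only-ab mu
    ... | inj₁ refl = avoids-permutation {ρ = ρ₁} (proj₂ ρ₁-extends) (proj₁ (colour-avoids (t a) (t b)))
    ... | inj₂ refl = avoids-permutation {ρ = ρ₂} (proj₂ ρ₂-extends) (proj₂ (colour-avoids (t a) (t b)))

    coupled-av : CoupledOff ρ₁ a v (extend v K T)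
    coupled-av h = begin
      3 * 2 * ∑[ t ∈ extend v K T ] h (t a) (t v)            ≡⟨ cong (3 * 2 *_) (∑-extend-pair v K T (key<⇒≢ a<v) h) ⟩
      3 * 2 * ∑[ t ∈ T ] (h (t a) (colour (t a) (t b)) + 0)  ≡⟨ cong (3 * 2 *_) (∑ₗ-cong T (λ t → +-identityʳ _)) ⟩
      3 * 2 * ∑[ t ∈ T ] h (t a) (colour (t a) (t b))        ≡⟨ proj₂ coupled-ab (λ i j → h i (colour i j)) ⟩
      length T * ∑-off σ (λ i j → h i (colour i j))          ≡⟨ cong (length T *_) (∑-off-colour h) ⟩
      length T * ∑-off ρ₁ h                                  ≡⟨ cong (_* ∑-off ρ₁ h) (trans (length-extend v K T) (*-identityˡ _)) ⟨
      length (extend v K T) * ∑-off ρ₁ h                     ∎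
      where open ≡-Reasoning

    coupled-v : ∀ {u} → Mate v u → CoMates u v → ∃ λ σ → CoupledOff σ u v (extend v K T)
    coupled-v mu uv with only-ab mu
    ... | inj₁ refl = ρ₁ , coupled-av
    ... | inj₂ refl = ⊥-elim (¬bv uv)

  extender : Extender
  extender v inv with length (mates v) | matesView v | length-mates W v
  ... | _ | none no-mates                | _ = step-noMate v no-mates inv
  ... | _ | one ma only-a                | _ = step-oneMate v ma only-a inv
  ... | _ | many                         | s≤s (s≤s ())
  ... | _ | two {b = b} ma mb a≢b only-ab | _ with coMates? b v
  ...   | no ¬bv = step-twoMates v ma mb a≢b only-ab ¬bv inv
  ...   | yes bv = step-twoMates v mb ma (≢-sym a≢b) (Sum.swap ∘ only-ab)
                     (λ av → coMates-exclusive W ma mb a≢b av bv) inv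

proposition5p2 : ∀ (n : ℕ) (G : Graph n) (p : ℕ) →
    p ≤ 2 → PathwidthAtMost G p → ChiCBulletAtMost G (suc p)
proposition5p2 n G 0 _ (D , W) = 1 , ≤-refl , λ C → Elimination.packing D C (Elimination.extender≤1 D C z≤n W)
proposition5p2 n G 1 _ (D , W) = 2 , ≤-refl , λ C → Elimination.packing D C (Elimination.extender≤1 D C (s≤s z≤n) W)
proposition5p2 n G 2 _ (D , W) = 3 , ≤-refl , λ C → Elimination.packing D C (WidthTwo.extender D W C)
proposition5p2 n G (suc (suc (suc p))) (s≤s (s≤s ())) _
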